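{- For every integer $n\geq 1$: (1) $\widetilde{Q}_{n}\overline{\widetilde{Q}_{n}}=3(\widetilde{F}_{2n+3}+\varepsilon F_{2n+4})$; (2) $\widetilde{Q}_{n}+\overline{\widetilde{Q}_{n}}=2\widetilde{F}_{n}$; (3) $\widetilde{Q}_{n}^{2}=2\widetilde{Q}_{n}\widetilde{F}_{n}-3(\widetilde{F}_{2n+3}+\varepsilon F_{2n+4})$; (4) $\widetilde{Q}_{n}\overline{\widetilde{Q}_{n}}+\widetilde{Q}_{n-1}\overline{\widetilde{Q}_{n-1}}=3(\widetilde{L}_{2n+2}+\varepsilon L_{2n+3})$; (5) $\widetilde{Q}_{n}^{2}+\widetilde{Q}_{n-1}^{2}=2\widetilde{Q}_{2n-1}-3\widetilde{L}_{2n+2}+\varepsilon(2Q_{2n}-3L_{2n+3})$.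
   Context: $F_n$ are the Fibonacci numbers ($F_0=0$, $F_1=1$, $F_{n+2}=F_{n+1}+F_n$) and $L_n$ the Lucas numbers ($L_0=2$, $L_1=1$, $L_{n+2}=L_{n+1}+L_n$). $\mathbb{H}$ is the real quaternion algebra with basis $1,i,j,k$, $i^2=j^2=k^2=-1$, $ij=-ji=k$, $jk=-kj=i$, $ki=-ik=j$, and quaternion conjugation is $\overline{q_0+iq_1+jq_2+kq_3}=q_0-iq_1-jq_2-kq_3$. $\varepsilon$ is a dual unit: $\varepsilon\neq0$, $\varepsilon^2=0$, commuting with all quaternions; a dual quaternion is $q+\varepsilon q^{*}$ ($q,q^*\in\mathbb{H}$), with componentwise addition, product $(q+\varepsilon q^{*})(p+\varepsilon p^{*})=qp+\varepsilon(qp^{*}+q^{*}p)$, and conjugate $\overline{q+\varepsilon q^*}=\overline{q}+\varepsilon\overline{q^*}$; dual numbers $a+\varepsilon b$ ($a,b$ real) are the scalar dual quaternions. The dual Fibonacci and dual Lucas numbers are $\widetilde{F}_n=F_n+\varepsilon F_{n+1}$ and $\widetilde{L}_n=L_n+\varepsilon L_{n+1}$. The Fibonacci quaternion is $Q_n=F_n+iF_{n+1}+jF_{n+2}+kF_{n+3}$ and the dual Fibonacci quaternion is $\widetilde{Q}_n=Q_n+\varepsilon Q_{n+1}$. -}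

module Defs where

open import Data.Nat using (ℕ; zero; suc)
open import Data.Integer using (ℤ; +_; _+_; _*_; -_; _-_)

fib : ℕ → ℤ
fib zero = + 0
fib (suc zero) = + 1
fib (suc (suc n)) = fib (suc n) + fib n

luc : ℕ → ℤ
luc zero = + 2
luc (suc zero) = + 1
luc (suc (suc n)) = luc (suc n) + luc n

-- Quaternions q0 + i q1 + j q2 + k q3 with integer coefficients
-- (the subring of the real quaternions containing all quantities involved)
record Quat : Set where
  constructor quat
  field
    q0 q1 q2 q3 : ℤ
open Quat public

infixl 6 _+Q_
infixl 7 _*Q_

_+Q_ : Quat → Quat → Quat
quat a0 a1 a2 a3 +Q quat b0 b1 b2 b3 = quat (a0 + b0) (a1 + b1) (a2 + b2) (a3 + b3)

-- Hamilton product: i²=j²=k²=-1, ij=k, jk=i, ki=j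
_*Q_ : Quat → Quat → Quat
quat a0 a1 a2 a3 *Q quat b0 b1 b2 b3 =
  quat (a0 * b0 - a1 * b1 - a2 * b2 - a3 * b3)
       (a0 * b1 + a1 * b0 + a2 * b3 - a3 * b2)
       (a0 * b2 - a1 * b3 + a2 * b0 + a3 * b1)
       (a0 * b3 + a1 * b2 - a2 * b1 + a3 * b0)

conjQ : Quat → Quat
conjQ (quat a0 a1 a2 a3) = quat a0 (- a1) (- a2) (- a3)

realQ : ℤ → Quat
realQ a = quat a (+ 0) (+ 0) (+ 0)

-- Dual quaternions q + ε q*
record DQuat : Set where
  constructor dquat
  field
    re du : Quat
open DQuat public

infixl 6 _+D_ _-D_
infixl 7 _*D_

_+D_ : DQuat → DQuat → DQuat
dquat q q* +D dquat p p* = dquat (q +Q p) (q* +Q p*)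

_*D_ : DQuat → DQuat → DQuat
dquat q q* *D dquat p p* = dquat (q *Q p) (q *Q p* +Q q* *Q p)

conjD : DQuat → DQuat
conjD (dquat q q*) = dquat (conjQ q) (conjQ q*)

dnum : ℤ → ℤ → DQuat
dnum a b = dquat (realQ a) (realQ b)

realD : ℤ → DQuat
realD a = dnum a (+ 0)

-- ε times a dual quaternion (ε² = 0)
epsD : DQuat → DQuat
epsD (dquat q q*) = dquat (realQ (+ 0)) q

negD : DQuat → DQuat
negD x = realD (- (+ 1)) *D x

_-D_ : DQuat → DQuat → DQuat
x -D y = x +D negD y

dfib : ℕ → DQuat
dfib n = dnum (fib n) (fib (suc n))

dluc : ℕ → DQuat
dluc n = dnum (luc n) (luc (suc n))

fibQ : ℕ → Quat
fibQ n = quat (fib n) (fib (suc n)) (fib (suc (suc n))) (fib (suc (suc (suc n))))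

dfibQ : ℕ → DQuat
dfibQ n = dquat (fibQ n) (fibQ (suc n))

quatD : Quat → DQuat
quatD q = dquat q (realQ (+ 0))

{-# OPTIONS --safe #-}
-- Put n = m + 1.  Every entry of the five identities is an integer polynomial in F_m, F_{m+1},
-- F_{2m+1}, F_{2m+2}, L_{2m+2}, L_{2m+3}, because all other indices are reached from these by the
-- Fibonacci recurrence.  The addition formula F_{i+j+1} = F_{i+1} F_{j+1} + F_i F_j gives
-- F_{2m+1} and F_{2m+2} as quadratic forms in F_m, F_{m+1}, and L_{k+1} = F_k + F_{k+2} expresses
-- the two Lucas numbers through them.  After these substitutions each identity is a polynomial
-- identity in F_m, F_{m+1} between dual quaternions, i.e. eight identities of integer
-- polynomials, and these are decided by comparing normal forms.
module Submission where

open import Defs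
open import Data.Nat using (ℕ; _≤_; _+_; _*_; _∸_)
open import Data.Integer using (+_)
open import Data.Product using (_×_)
open import Relation.Binary.PropositionalEquality using (_≡_)

open import Data.Fin using (#_)
open import Data.Integer as ℤ using (ℤ)
open import Data.Integer.Properties using (+-commutativeSemigroup)
open import Algebra.Properties.CommutativeSemigroup +-commutativeSemigroup using (interchange)
open import Data.Integer.Solver using (module +-*-Solver)
open +-*-Solver using (Polynomial; con; var; _:+_; _:*_; _:-_; :-_; ⟦_⟧; ⟦_⟧N; normalise; correct)
import Data.Integer.Tactic.RingSolver as ℤ-Solver
open import Data.Nat using (zero; suc)
open import Data.Nat.Properties using (+-suc)
import Data.Nat.Tactic.RingSolver as ℕ-Solver
open import Data.Product using (_,_)
open import Data.Vec using (Vec; []; _∷_)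
open import Function using (_∘_)
open import Relation.Binary.PropositionalEquality using (refl; sym; trans; cong; cong₂; module ≡-Reasoning)

fib-+ : ∀ i j → fib (suc (i + j)) ≡ fib (suc i) ℤ.* fib (suc j) ℤ.+ fib i ℤ.* fib j
fib-+ zero    j = unit-coefficients (fib (suc j)) (fib j)
  where
  unit-coefficients : ∀ x y → x ≡ + 1 ℤ.* x ℤ.+ + 0 ℤ.* y
  unit-coefficients = ℤ-Solver.solve-∀
fib-+ (suc i) j = begin
  fib (suc (suc (i + j)))                                     ≡⟨ cong (fib ∘ suc) (sym (+-suc i j)) ⟩
  fib (suc (i + suc j))                                       ≡⟨ fib-+ i (suc j) ⟩
  fib (suc i) ℤ.* fib (suc (suc j)) ℤ.+ fib i ℤ.* fib (suc j) ≡⟨ regroup (fib i) (fib (suc i)) (fib j) (fib (suc j)) ⟩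
  fib (suc (suc i)) ℤ.* fib (suc j) ℤ.+ fib (suc i) ℤ.* fib j ∎
  where
  open ≡-Reasoning
  regroup : ∀ a b c d → b ℤ.* (d ℤ.+ c) ℤ.+ a ℤ.* d ≡ (b ℤ.+ a) ℤ.* d ℤ.+ b ℤ.* c
  regroup = ℤ-Solver.solve-∀

fib-double+2 : ∀ m → fib (2 + (m + m)) ≡ fib (suc m) ℤ.* fib (suc (suc m)) ℤ.+ fib m ℤ.* fib (suc m)
fib-double+2 m = trans (cong (fib ∘ suc) (sym (+-suc m m))) (fib-+ m (suc m))

luc-suc : ∀ k → luc (suc k) ≡ fib k ℤ.+ fib (suc (suc k))
luc-suc zero          = refl
luc-suc (suc zero)    = refl
luc-suc (suc (suc k)) =
  trans (cong₂ ℤ._+_ (luc-suc (suc k)) (luc-suc k))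
        (interchange (fib (suc k)) (fib (suc (suc (suc k)))) (fib k) (fib (suc (suc k))))

record QuatOver (A : Set) : Set where
  constructor quatᴾ
  field c₀ c₁ c₂ c₃ : A
open QuatOver

record DQuatOver (A : Set) : Set where
  constructor dquatᴾ
  field reᴾ duᴾ : QuatOver A
open DQuatOver

mapQ : ∀ {A B : Set} → (A → B) → QuatOver A → QuatOver B
mapQ f (quatᴾ a₀ a₁ a₂ a₃) = quatᴾ (f a₀) (f a₁) (f a₂) (f a₃)

mapD : ∀ {A B : Set} → (A → B) → DQuatOver A → DQuatOver B
mapD f (dquatᴾ q q*) = dquatᴾ (mapQ f q) (mapQ f q*)

Quatᴾ DQuatᴾ : ℕ → Set
Quatᴾ k  = QuatOver (Polynomial k)
DQuatᴾ k = DQuatOver (Polynomial k)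

⟦_⟧Q : ∀ {k} → Quatᴾ k → Vec ℤ k → Quat
⟦ quatᴾ a₀ a₁ a₂ a₃ ⟧Q ρ = quat (⟦ a₀ ⟧ ρ) (⟦ a₁ ⟧ ρ) (⟦ a₂ ⟧ ρ) (⟦ a₃ ⟧ ρ)

⟦_⟧D : ∀ {k} → DQuatᴾ k → Vec ℤ k → DQuat
⟦ dquatᴾ q q* ⟧D ρ = dquat (⟦ q ⟧Q ρ) (⟦ q* ⟧Q ρ)

normalise≡⇒⟦⟧≡ : ∀ {k} (p q : Polynomial k) → normalise p ≡ normalise q → ∀ ρ → ⟦ p ⟧ ρ ≡ ⟦ q ⟧ ρ
normalise≡⇒⟦⟧≡ p q same ρ =
  trans (sym (correct p ρ)) (trans (cong (λ nf → ⟦ nf ⟧N ρ) same) (correct q ρ))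

quat-cong : ∀ {a₀ a₁ a₂ a₃ b₀ b₁ b₂ b₃ : ℤ} →
  a₀ ≡ b₀ → a₁ ≡ b₁ → a₂ ≡ b₂ → a₃ ≡ b₃ → quat a₀ a₁ a₂ a₃ ≡ quat b₀ b₁ b₂ b₃
quat-cong refl refl refl refl = refl

normaliseQ≡⇒⟦⟧Q≡ : ∀ {k} (x y : Quatᴾ k) → mapQ normalise x ≡ mapQ normalise y →
  ∀ ρ → ⟦ x ⟧Q ρ ≡ ⟦ y ⟧Q ρ
normaliseQ≡⇒⟦⟧Q≡ (quatᴾ a₀ a₁ a₂ a₃) (quatᴾ b₀ b₁ b₂ b₃) same ρ =
  quat-cong (normalise≡⇒⟦⟧≡ a₀ b₀ (cong c₀ same) ρ) (normalise≡⇒⟦⟧≡ a₁ b₁ (cong c₁ same) ρ)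
            (normalise≡⇒⟦⟧≡ a₂ b₂ (cong c₂ same) ρ) (normalise≡⇒⟦⟧≡ a₃ b₃ (cong c₃ same) ρ)

normaliseD≡⇒⟦⟧D≡ : ∀ {k} (x y : DQuatᴾ k) → mapD normalise x ≡ mapD normalise y →
  ∀ ρ → ⟦ x ⟧D ρ ≡ ⟦ y ⟧D ρ
normaliseD≡⇒⟦⟧D≡ (dquatᴾ q q*) (dquatᴾ p p*) same ρ =
  cong₂ dquat (normaliseQ≡⇒⟦⟧Q≡ q p (cong reᴾ same) ρ) (normaliseQ≡⇒⟦⟧Q≡ q* p* (cong duᴾ same) ρ)

-- These mirror the operations of Defs clause by clause, so ⟦_⟧D commutes with each of them
-- definitionally.
module _ {k : ℕ} where
  infixl 6 _+Qᴾ_ _+Dᴾ_ _-Dᴾ_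
  infixl 7 _*Qᴾ_ _*Dᴾ_

  _+Qᴾ_ : Quatᴾ k → Quatᴾ k → Quatᴾ k
  quatᴾ a₀ a₁ a₂ a₃ +Qᴾ quatᴾ b₀ b₁ b₂ b₃ = quatᴾ (a₀ :+ b₀) (a₁ :+ b₁) (a₂ :+ b₂) (a₃ :+ b₃)

  _*Qᴾ_ : Quatᴾ k → Quatᴾ k → Quatᴾ k
  quatᴾ a₀ a₁ a₂ a₃ *Qᴾ quatᴾ b₀ b₁ b₂ b₃ =
    quatᴾ (a₀ :* b₀ :- a₁ :* b₁ :- a₂ :* b₂ :- a₃ :* b₃)
          (a₀ :* b₁ :+ a₁ :* b₀ :+ a₂ :* b₃ :- a₃ :* b₂)
          (a₀ :* b₂ :- a₁ :* b₃ :+ a₂ :* b₀ :+ a₃ :* b₁)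
          (a₀ :* b₃ :+ a₁ :* b₂ :- a₂ :* b₁ :+ a₃ :* b₀)

  conjQᴾ : Quatᴾ k → Quatᴾ k
  conjQᴾ (quatᴾ a₀ a₁ a₂ a₃) = quatᴾ a₀ (:- a₁) (:- a₂) (:- a₃)

  realQᴾ : Polynomial k → Quatᴾ k
  realQᴾ a = quatᴾ a (con (+ 0)) (con (+ 0)) (con (+ 0))

  _+Dᴾ_ : DQuatᴾ k → DQuatᴾ k → DQuatᴾ k
  dquatᴾ q q* +Dᴾ dquatᴾ p p* = dquatᴾ (q +Qᴾ p) (q* +Qᴾ p*)

  _*Dᴾ_ : DQuatᴾ k → DQuatᴾ k → DQuatᴾ k
  dquatᴾ q q* *Dᴾ dquatᴾ p p* = dquatᴾ (q *Qᴾ p) (q *Qᴾ p* +Qᴾ q* *Qᴾ p)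

  conjDᴾ : DQuatᴾ k → DQuatᴾ k
  conjDᴾ (dquatᴾ q q*) = dquatᴾ (conjQᴾ q) (conjQᴾ q*)

  dnumᴾ : Polynomial k → Polynomial k → DQuatᴾ k
  dnumᴾ a b = dquatᴾ (realQᴾ a) (realQᴾ b)

  realDᴾ : Polynomial k → DQuatᴾ k
  realDᴾ a = dnumᴾ a (con (+ 0))

  epsDᴾ : DQuatᴾ k → DQuatᴾ k
  epsDᴾ (dquatᴾ q q*) = dquatᴾ (realQᴾ (con (+ 0))) q

  _-Dᴾ_ : DQuatᴾ k → DQuatᴾ k → DQuatᴾ k
  x -Dᴾ y = x +Dᴾ realDᴾ (con (ℤ.- + 1)) *Dᴾ y

  quatDᴾ : Quatᴾ k → DQuatᴾ k
  quatDᴾ q = dquatᴾ q (realQᴾ (con (+ 0)))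

  gibᴾ : Polynomial k → Polynomial k → ℕ → Polynomial k
  gibᴾ x y zero          = x
  gibᴾ x y (suc zero)    = y
  gibᴾ x y (suc (suc j)) = gibᴾ x y (suc j) :+ gibᴾ x y j

  gibQᴾ : Polynomial k → Polynomial k → ℕ → Quatᴾ k
  gibQᴾ x y j = quatᴾ (gibᴾ x y j) (gibᴾ x y (1 + j)) (gibᴾ x y (2 + j)) (gibᴾ x y (3 + j))

  dgibQᴾ : Polynomial k → Polynomial k → ℕ → DQuatᴾ k
  dgibQᴾ x y j = dquatᴾ (gibQᴾ x y j) (gibQᴾ x y (suc j))

  dgibᴾ : Polynomial k → Polynomial k → ℕ → DQuatᴾ k
  dgibᴾ x y j = dnumᴾ (gibᴾ x y j) (gibᴾ x y (suc j))

-- The five identities for n = m + 1, with a, b, u, v, p, r standing for F_m, F_{m+1}, F_{2m+1},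
-- F_{2m+2}, L_{2m+2}, L_{2m+3}; so gibᴾ a b j is F_{m+j}, gibᴾ u v j is F_{2m+1+j} and
-- gibᴾ p r j is L_{2m+2+j}.
module Theorem3ᴾ {k : ℕ} (a b u v p r : Polynomial k) where
  Q Q₋ F̃ norm : DQuatᴾ k
  Q    = dgibQᴾ a b 1
  Q₋   = dgibQᴾ a b 0
  F̃    = dgibᴾ a b 1
  norm = realDᴾ (con (+ 3)) *Dᴾ (dgibᴾ u v 4 +Dᴾ epsDᴾ (realDᴾ (gibᴾ u v 5)))

  lhs₁ rhs₁ lhs₂ rhs₂ lhs₃ rhs₃ lhs₄ rhs₄ lhs₅ rhs₅ : DQuatᴾ k
  lhs₁ = Q *Dᴾ conjDᴾ Q
  rhs₁ = norm
  lhs₂ = Q +Dᴾ conjDᴾ Q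
  rhs₂ = realDᴾ (con (+ 2)) *Dᴾ F̃
  lhs₃ = Q *Dᴾ Q
  rhs₃ = (realDᴾ (con (+ 2)) *Dᴾ Q *Dᴾ F̃) -Dᴾ norm
  lhs₄ = Q *Dᴾ conjDᴾ Q +Dᴾ Q₋ *Dᴾ conjDᴾ Q₋
  rhs₄ = realDᴾ (con (+ 3)) *Dᴾ (dgibᴾ p r 2 +Dᴾ epsDᴾ (realDᴾ (gibᴾ p r 3)))
  lhs₅ = Q *Dᴾ Q +Dᴾ Q₋ *Dᴾ Q₋
  rhs₅ = (realDᴾ (con (+ 2)) *Dᴾ dgibQᴾ u v 0) -Dᴾ (realDᴾ (con (+ 3)) *Dᴾ dgibᴾ p r 2)
         +Dᴾ epsDᴾ ((realDᴾ (con (+ 2)) *Dᴾ quatDᴾ (gibQᴾ u v 1))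
                    -Dᴾ (realDᴾ (con (+ 3)) *Dᴾ realDᴾ (gibᴾ p r 3)))

  Holds : Vec ℤ k → Set
  Holds ρ = (⟦ lhs₁ ⟧D ρ ≡ ⟦ rhs₁ ⟧D ρ) × (⟦ lhs₂ ⟧D ρ ≡ ⟦ rhs₂ ⟧D ρ) × (⟦ lhs₃ ⟧D ρ ≡ ⟦ rhs₃ ⟧D ρ)
          × (⟦ lhs₄ ⟧D ρ ≡ ⟦ rhs₄ ⟧D ρ) × (⟦ lhs₅ ⟧D ρ ≡ ⟦ rhs₅ ⟧D ρ)

module InTwoVariables where
  A B U V P R : Polynomial 2
  A = var (# 0)
  B = var (# 1)
  U = B :* B :+ A :* A
  V = B :* (B :+ A) :+ A :* B
  P = U :+ (V :+ U)
  R = V :+ ((V :+ U) :+ V)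

  open Theorem3ᴾ A B U V P R

  holds : ∀ a b → Holds (a ∷ b ∷ [])
  holds a b = by lhs₁ rhs₁ refl , by lhs₂ rhs₂ refl , by lhs₃ rhs₃ refl
            , by lhs₄ rhs₄ refl , by lhs₅ rhs₅ refl
    where
    by : ∀ x y → mapD normalise x ≡ mapD normalise y → ⟦ x ⟧D (a ∷ b ∷ []) ≡ ⟦ y ⟧D (a ∷ b ∷ [])
    by x y same = normaliseD≡⇒⟦⟧D≡ x y same (a ∷ b ∷ [])

module InSixVariables where
  open Theorem3ᴾ {k = 6} (var (# 0)) (var (# 1)) (var (# 2)) (var (# 3)) (var (# 4)) (var (# 5))

  -- Once the equations are matched, the environment consists of the values of A, B, U, V, P, R at
  -- (a, b), so evaluating in six variables is definitionally the two-variable evaluation.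
  holds : ∀ a b u v p r →
    u ≡ b ℤ.* b ℤ.+ a ℤ.* a → v ≡ b ℤ.* (b ℤ.+ a) ℤ.+ a ℤ.* b →
    p ≡ u ℤ.+ (v ℤ.+ u) → r ≡ v ℤ.+ ((v ℤ.+ u) ℤ.+ v) →
    Holds (a ∷ b ∷ u ∷ v ∷ p ∷ r ∷ [])
  holds a b _ _ _ _ refl refl refl refl = InTwoVariables.holds a b

-- The indices 2n − 1, 2n, 2n + 2, 2n + 3, 2n + 4 are abstracted: for n = m + 1 they do not
-- compute to successors of m + m, so they have to be moved along equations.
Theorem3-at : (n i₋ i₀ i₂ i₃ i₄ : ℕ) → Set
Theorem3-at n i₋ i₀ i₂ i₃ i₄ =
    (dfibQ n *D conjD (dfibQ n)
       ≡ realD (+ 3) *D (dfib i₃ +D epsD (realD (fib i₄))))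
  × (dfibQ n +D conjD (dfibQ n) ≡ realD (+ 2) *D dfib n)
  × (dfibQ n *D dfibQ n
       ≡ (realD (+ 2) *D dfibQ n *D dfib n)
         -D (realD (+ 3) *D (dfib i₃ +D epsD (realD (fib i₄)))))
  × (dfibQ n *D conjD (dfibQ n) +D dfibQ (n ∸ 1) *D conjD (dfibQ (n ∸ 1))
       ≡ realD (+ 3) *D (dluc i₂ +D epsD (realD (luc i₃))))
  × (dfibQ n *D dfibQ n +D dfibQ (n ∸ 1) *D dfibQ (n ∸ 1)
       ≡ (realD (+ 2) *D dfibQ i₋) -D (realD (+ 3) *D dluc i₂)
         +D epsD ((realD (+ 2) *D quatD (fibQ i₀)) -D (realD (+ 3) *D realD (luc i₃))))

Theorem3-at-reindex : ∀ n {i₋ i₀ i₂ i₃ i₄ j₋ j₀ j₂ j₃ j₄} →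
  i₋ ≡ j₋ → i₀ ≡ j₀ → i₂ ≡ j₂ → i₃ ≡ j₃ → i₄ ≡ j₄ →
  Theorem3-at n j₋ j₀ j₂ j₃ j₄ → Theorem3-at n i₋ i₀ i₂ i₃ i₄
Theorem3-at-reindex n refl refl refl refl refl holds = holds

Theorem3-at-suc : ∀ m → let k = m + m in Theorem3-at (suc m) (1 + k) (2 + k) (4 + k) (5 + k) (6 + k)
Theorem3-at-suc m =
  InSixVariables.holds (fib m) (fib (suc m)) (fib (1 + k)) (fib (2 + k)) (luc (2 + k)) (luc (3 + k))
    (fib-+ m m) (fib-double+2 m) (luc-suc (1 + k)) (luc-suc (2 + k))
  where
  k : ℕ
  k = m + m

double-suc : ∀ m → 2 * suc m ≡ 2 + (m + m)
double-suc = ℕ-Solver.solve-∀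

double-suc+ : ∀ m j → 2 * suc m + j ≡ 2 + j + (m + m)
double-suc+ = ℕ-Solver.solve-∀

theorem3 : (n : ℕ) → 1 ≤ n →
    (dfibQ n *D conjD (dfibQ n)
       ≡ realD (+ 3) *D (dfib (2 * n + 3) +D epsD (realD (fib (2 * n + 4)))))
  × (dfibQ n +D conjD (dfibQ n) ≡ realD (+ 2) *D dfib n)
  × (dfibQ n *D dfibQ n
       ≡ (realD (+ 2) *D dfibQ n *D dfib n)
         -D (realD (+ 3) *D (dfib (2 * n + 3) +D epsD (realD (fib (2 * n + 4))))))
  × (dfibQ n *D conjD (dfibQ n) +D dfibQ (n ∸ 1) *D conjD (dfibQ (n ∸ 1))
       ≡ realD (+ 3) *D (dluc (2 * n + 2) +D epsD (realD (luc (2 * n + 3)))))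
  × (dfibQ n *D dfibQ n +D dfibQ (n ∸ 1) *D dfibQ (n ∸ 1)
       ≡ (realD (+ 2) *D dfibQ (2 * n ∸ 1)) -D (realD (+ 3) *D dluc (2 * n + 2))
         +D epsD ((realD (+ 2) *D quatD (fibQ (2 * n))) -D (realD (+ 3) *D realD (luc (2 * n + 3)))))
theorem3 zero ()
theorem3 (suc m) _ =
  Theorem3-at-reindex (suc m) (cong (_∸ 1) (double-suc m)) (double-suc m)
    (double-suc+ m 2) (double-suc+ m 3) (double-suc+ m 4) (Theorem3-at-suc m)
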